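{- Let $p$ be an odd prime, let $\varphi\in\mathbb{Z}$ satisfy $\varphi^4+4\varphi^2+1\equiv 0\pmod p$, and let $u,v$ be integers with $u\equiv\varphi\pmod p$ and $v\equiv -1\pmod p$. Then the sequences $(\alpha_i)_{i\ge1}$, $(\beta_i)_{i\ge 1}$ defined below satisfy, for all $k\ge 0$: $\alpha_{3k+1}\equiv-\varphi$, $\alpha_{3k+2}+\alpha_{3k+3}\equiv\varphi\pmod p$; $\alpha_{9k+2}\equiv-\varphi^{ -1}$, $\alpha_{9k+5}\equiv\alpha_{3k+3}$, $\alpha_{9k+8}\equiv\varphi+\varphi^{ -1}\pmod p$; $\beta_1\equiv 1$, $\beta_2\equiv\varphi^2+1$, $\beta_{3k+3}\equiv\varphi^{ -2}$, $\beta_{3k+4}+\beta_{3k+5}\equiv\varphi^2+1\pmod p$; $\beta_{9k+1}\equiv\beta_{3k+1}$, $\beta_{9k+4}\equiv\varphi^2$, $\beta_{9k+7}\equiv 1\pmod p$.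
   Context: Given $u,v$, define rational numbers $\alpha_i,\beta_i$ ($i\ge 1$) by $\alpha_1=-u$, $\alpha_2=\frac{u(2v-1-u^2)}{v-u^2}$, $\alpha_3=\frac{ -u(v-1)}{v-u^2}$, $\beta_1=1$, $\beta_2=u^2-v$, $\beta_3=\frac{u^2+u^4+v^3-3u^2v}{(v-u^2)^2}$, and for every $k\ge 0$: $\alpha_{3k+4}=-u$, $\beta_{3k+4}=\frac{\beta_{k+2}}{\beta_{3k+3}\beta_{3k+2}}$, $\beta_{3k+5}=u^2-v-\beta_{3k+4}$, $\alpha_{3k+5}=u-\frac{\alpha_{k+2}+uv-\alpha_{3k+2}\beta_{3k+4}}{\beta_{3k+5}}$, $\alpha_{3k+6}=u-\alpha_{3k+5}$, $\beta_{3k+6}=v-\alpha_{3k+5}\alpha_{3k+6}$. Congruences modulo $p$ between rational numbers are understood in the local ring $\mathbb{Z}_{(p)}$ of rationals with denominator prime to $p$; asserting such a congruence for $\alpha_i$ or $\beta_i$ includes that it is well defined (no division by zero) and lies in $\mathbb{Z}_{(p)}$. Here $\varphi^{ -1}$ denotes the inverse of $\varphi$ modulo $p$ (note $\varphi\not\equiv0$). -}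

module Defs where

open import Data.Nat as ℕ using (ℕ; zero; suc)
open import Data.Nat.DivMod using (_/_; _%_)
open import Data.Integer as ℤ using (ℤ)
open import Data.Integer.Divisibility as ℤD using ()
open import Data.Rational as ℚ using (ℚ; ↥_; ↧_; 0ℚ; 1ℚ; NonZero; _÷_; ≢-nonZero)
open import Data.Rational.Properties using (_≟_)
open import Data.Maybe using (Maybe; just; nothing)
open import Data.Product using (_×_; _,_; proj₁; proj₂; ∃)
open import Relation.Nullary using (¬_; yes; no)
open import Relation.Binary.PropositionalEquality using (_≡_)

-- Partial arithmetic on ℚ: `nothing` = "not well defined"
-- (division by zero somewhere).

_+M_ : Maybe ℚ → Maybe ℚ → Maybe ℚ
just x +M just y = just (x ℚ.+ y)
_ +M _ = nothing

_-M_ : Maybe ℚ → Maybe ℚ → Maybe ℚ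
just x -M just y = just (x ℚ.- y)
_ -M _ = nothing

_*M_ : Maybe ℚ → Maybe ℚ → Maybe ℚ
just x *M just y = just (x ℚ.* y)
_ *M _ = nothing

_/M_ : Maybe ℚ → Maybe ℚ → Maybe ℚ
just x /M just y with y ≟ 0ℚ
... | yes _  = nothing
... | no y≢0 = just (_÷_ x y {{≢-nonZero y≢0}})
_ /M _ = nothing

infixl 6 _+M_ _-M_
infixl 7 _*M_ _/M_

ι : ℤ → Maybe ℚ
ι z = just (z ℚ./ 1)

-- The sequences (α_i, β_i), i ≥ 1 (index 0 is unused and undefined).
-- `ab fuel i` computes (α_i , β_i) by recursion on a fuel parameter;
-- every recursive reference is to a strictly smaller index, so fuel = i
-- suffices.

module Seq (u v : ℤ) where
  U V : Maybe ℚ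
  U = ι u
  V = ι v

  one : Maybe ℚ
  one = just 1ℚ

  block : (ℕ → Maybe ℚ × Maybe ℚ) → ℕ → ℕ → Maybe ℚ × Maybe ℚ
  block rec k r = blk r
    where
      a b : ℕ → Maybe ℚ
      a j = proj₁ (rec j)
      b j = proj₂ (rec j)
      -- index 3k+4
      a4 b4 : Maybe ℚ
      a4 = ι (ℤ.- u)
      b4 = b (k ℕ.+ 2) /M (b (3 ℕ.* k ℕ.+ 3) *M b (3 ℕ.* k ℕ.+ 2))
      -- index 3k+5
      b5 a5 : Maybe ℚ
      b5 = U *M U -M V -M b4
      a5 = U -M (a (k ℕ.+ 2) +M U *M V -M a (3 ℕ.* k ℕ.+ 2) *M b4) /M b5
      -- index 3k+6
      a6 b6 : Maybe ℚ
      a6 = U -M a5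
      b6 = V -M a5 *M a6
      blk : ℕ → Maybe ℚ × Maybe ℚ
      blk 0 = a4 , b4
      blk 1 = a5 , b5
      blk 2 = a6 , b6
      blk _ = nothing , nothing

  ab : ℕ → ℕ → Maybe ℚ × Maybe ℚ
  ab zero _ = nothing , nothing
  ab (suc n) 0 = nothing , nothing
  ab (suc n) 1 = ι (ℤ.- u) , one
  ab (suc n) 2 =
      U *M (ι (ℤ.+ 2) *M V -M one -M U *M U) /M (V -M U *M U)
    , U *M U -M V
  ab (suc n) 3 =
      ι (ℤ.- u) *M (V -M one) /M (V -M U *M U)
    , (U *M U +M U *M U *M U *M U +M V *M V *M V -M ι (ℤ.+ 3) *M U *M U *M V)
        /M ((V -M U *M U) *M (V -M U *M U))
  ab (suc n) (suc (suc (suc (suc j)))) = block (ab n) (j / 3) (j % 3)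

  α β : ℕ → Maybe ℚ
  α i = proj₁ (ab i i)
  β i = proj₂ (ab i i)

infix 4 _≡_[modℚ_] _≡M_[mod_] _≡ℤ_[mod_]

-- q ∈ ℤ_(p): the (reduced) denominator of q is prime to p.
InZ[_] : ℕ → ℚ → Set
InZ[ p ] q = ¬ (ℤ.+ p ℤD.∣ ↧ q)

_≡_[modℚ_] : ℚ → ℚ → ℕ → Set
x ≡ y [modℚ p ] = InZ[ p ] x × InZ[ p ] y × (ℤ.+ p ℤD.∣ ↥ (x ℚ.- y))

_≡M_[mod_] : Maybe ℚ → Maybe ℚ → ℕ → Set
mx ≡M my [mod p ] = ∃ λ x → ∃ λ y → (mx ≡ just x) × (my ≡ just y) × (x ≡ y [modℚ p ])

_≡ℤ_[mod_] : ℤ → ℤ → ℕ → Set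
a ≡ℤ b [mod p ] = ℤ.+ p ℤD.∣ (a ℤ.- b)

-- Track residues in ℤ_(p): every α_i, β_i turns out to be well defined and p-integral.
-- Group the indices into blocks {3j+1, 3j+2, 3j+3}. Modulo p, block j is governed by two
-- residues, A of α_{3j+2} and a unit D of β_{3j+2}: then α_{3j+1} ≡ −φ, α_{3j+3} ≡ φ − A,
-- β_{3j+3} ≡ ψ², β_{3j+1} ≡ φ² + 1 − D (j ≥ 1), and A is a root of X² − φX − (1 + ψ²),
-- whose roots are −ψ and φ + ψ. The recurrence computes block k + 1 from block k and the
-- index k + 2, which lies in block ⌊(k + 1)/3⌋. Following the two divisions shows that if
-- block m has residues (A, D), then blocks 3m, 3m + 1, 3m + 2 have residues (−ψ, D),
-- (φ − A, 1) and (φ + ψ, φ²), so strong induction on m determines every block. All the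
-- congruences needed are explicit combinations of φψ ≡ 1 and φ⁴ + 4φ² + 1 ≡ 0.

module Submission where

open import Defs
open import Data.Nat as ℕ using (ℕ)
open import Data.Nat.DivMod using (_%_)
open import Data.Nat.Primality using (Prime)
open import Data.Integer as ℤ using (ℤ; +_; -[1+_])
open import Data.Product using (_×_)
open import Relation.Binary.PropositionalEquality using (_≡_)

open import Data.Empty using (⊥-elim)
open import Data.List using (_∷_; [])
open import Data.Maybe using (Maybe; just)
open import Data.Rational using (ℚ)
open import Data.Product using (_,_; proj₁; proj₂)
open import Data.Sum as Sum using (_⊎_; [_,_])
open import Function using (id; _∘_)
open import Relation.Nullary using (¬_; yes; no)
open import Relation.Binary.PropositionalEquality
  using (refl; sym; trans; cong; cong₂; subst; subst₂; module ≡-Reasoning)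

module ModularArithmetic (p : ℕ) (p-prime : Prime p) where

  open import Data.Nat.Divisibility using (∣⇒≤; ∣1⇒≡1) renaming (_∣_ to _∣ℕ_)
  open import Data.Nat.Primality using (¬prime[1]; euclidsLemma)
  open import Data.Integer using (_+_; _*_; _-_; -_)
  open import Data.Integer.Properties using (abs-*; neg-involutive; +-identityʳ; +-inverseʳ)
  open import Data.Integer.Divisibility.Signed
    using (_∣_; divides; ∣m∣n⇒∣m+n; ∣m∣n⇒∣m-n; ∣n⇒∣m*n; ∣m⇒∣m*n; ∣m⇒∣-m; ∣ᵤ⇒∣; ∣⇒∣ᵤ)
  open import Data.Integer.Tactic.RingSolver using (solve)

  infix 4 _≈_

  -- A record rather than a synonym for  + p ∣ a - b,  so that a and b can be read off
  -- the type by unification: the ring-solver calls in argument position rely on this.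
  record _≈_ (a b : ℤ) : Set where
    constructor mk≈
    field p∣a-b : + p ∣ a - b

  ≈-from-mod : ∀ {a b} → a ≡ℤ b [mod p ] → a ≈ b
  ≈-from-mod = mk≈ ∘ ∣ᵤ⇒∣

  ≈-reflexive : ∀ {a b} → a ≡ b → a ≈ b
  ≈-reflexive {a} refl = mk≈ (divides (+ 0) (+-inverseʳ a))

  ≈-linear₁ : ∀ {a b x x′} c → x ≈ x′ → a - b ≡ c * (x - x′) → a ≈ b
  ≈-linear₁ c (mk≈ d) eq = mk≈ (subst (+ p ∣_) (sym eq) (∣n⇒∣m*n c d))

  ≈-linear₂ : ∀ {a b x x′ y y′} c₁ c₂ → x ≈ x′ → y ≈ y′ →
              a - b ≡ c₁ * (x - x′) + c₂ * (y - y′) → a ≈ b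
  ≈-linear₂ c₁ c₂ (mk≈ d₁) (mk≈ d₂) eq =
    mk≈ (subst (+ p ∣_) (sym eq) (∣m∣n⇒∣m+n (∣n⇒∣m*n c₁ d₁) (∣n⇒∣m*n c₂ d₂)))

  ≈-trans : ∀ {a b c} → a ≈ b → b ≈ c → a ≈ c
  ≈-trans {a} {b} {c} a≈b b≈c = ≈-linear₂ (+ 1) (+ 1) a≈b b≈c (solve (a ∷ b ∷ c ∷ []))

  ≈0⇒∣ : ∀ {a} → a ≈ + 0 → + p ∣ a
  ≈0⇒∣ {a} (mk≈ d) = subst (+ p ∣_) (+-identityʳ a) d

  p≢1 : ¬ p ≡ 1
  p≢1 refl = ¬prime[1] p-prime

  ∣-prime : ∀ a b → + p ∣ a * b → + p ∣ a ⊎ + p ∣ b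
  ∣-prime a b p∣ab = Sum.map ∣ᵤ⇒∣ ∣ᵤ⇒∣
    (euclidsLemma ℤ.∣ a ∣ ℤ.∣ b ∣ p-prime (subst (p ∣ℕ_) (abs-* a b) (∣⇒∣ᵤ p∣ab)))

  ∤-* : ∀ {a b} → ¬ (+ p ∣ a) → ¬ (+ p ∣ b) → ¬ (+ p ∣ a * b)
  ∤-* {a} {b} p∤a p∤b = [ p∤a , p∤b ] ∘ ∣-prime a b

  ∣-cancelʳ : ∀ {a b} → ¬ (+ p ∣ b) → + p ∣ a * b → + p ∣ a
  ∣-cancelʳ {a} {b} p∤b = [ id , ⊥-elim ∘ p∤b ] ∘ ∣-prime a b

  ∤-neg : ∀ {a} → ¬ (+ p ∣ a) → ¬ (+ p ∣ - a)
  ∤-neg {a} p∤a = p∤a ∘ subst (+ p ∣_) (neg-involutive a) ∘ ∣m⇒∣-m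

  ∤-resp-≈ : ∀ {a b} → a ≈ b → ¬ (+ p ∣ b) → ¬ (+ p ∣ a)
  ∤-resp-≈ {a} {b} (mk≈ d) p∤b p∣a = p∤b (subst (+ p ∣_) a-[a-b]≡b (∣m∣n⇒∣m-n p∣a d))
    where
      a-[a-b]≡b : a - (a - b) ≡ b
      a-[a-b]≡b = solve (a ∷ b ∷ [])

  ∤1 : ¬ (+ p ∣ + 1)
  ∤1 = p≢1 ∘ ∣1⇒≡1 ∘ ∣⇒∣ᵤ

  ∤-invertible : ∀ {a b} → a * b ≈ + 1 → ¬ (+ p ∣ a)
  ∤-invertible {a} {b} ab≈1 = ∤-resp-≈ ab≈1 ∤1 ∘ ∣m⇒∣m*n b

  ∤2 : p % 2 ≡ 1 → ¬ (+ p ∣ + 2)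
  ∤2 p-odd p∣2 = p≢1 (odd≤2⇒≡1 p-odd (∣⇒≤ (∣⇒∣ᵤ p∣2)))
    where
      odd≤2⇒≡1 : ∀ {n} → n % 2 ≡ 1 → n ℕ.≤ 2 → n ≡ 1
      odd≤2⇒≡1 {0} () _
      odd≤2⇒≡1 {1} _  _ = refl
      odd≤2⇒≡1 {2} () _
      odd≤2⇒≡1 {ℕ.suc (ℕ.suc (ℕ.suc _))} _ (ℕ.s≤s (ℕ.s≤s ()))

module Residues (p : ℕ) (p-prime : Prime p) where

  open ModularArithmetic p p-prime
  open import Data.Integer using (_+_; _*_; _-_; -_)
  open import Data.Integer.Properties using (*-identityʳ)
  open import Data.Integer.Divisibility.Signed using (_∣_; ∣n⇒∣m*n; ∣m⇒∣m*n; ∣m⇒∣-m; ∣ᵤ⇒∣; ∣⇒∣ᵤ)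
  open import Data.Integer.Tactic.RingSolver using (solve)
  open import Data.Nat.Coprimality using (recompute)
  open import Data.Rational as ℚ using (mkℚ; ↥_; ↧_; 0ℚ; _÷_)
  open import Data.Rational.Properties using (↥-/; ↧-/; ↥-*; ↧-*; ↥-neg; ↧-neg)
  import Data.Rational.Properties as ℚ

  record HasResidue (x : ℚ) (c : ℤ) : Set where
    constructor has-residue
    field
      ↧-unit : ¬ (+ p ∣ ↧ x)
      ↥≈    : ↥ x ≈ c * ↧ x

  ↥↧-coprime : ∀ x → + p ∣ ↥ x → ¬ (+ p ∣ ↧ x)
  ↥↧-coprime (mkℚ _ _ coprime) p∣↥ p∣↧ = p≢1 (recompute coprime (∣⇒∣ᵤ p∣↥ , ∣⇒∣ᵤ p∣↧))

  cross-multiply : ∀ a b {g n d} → a * g ≡ n → b * g ≡ d → a * d ≡ n * b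
  cross-multiply a b {g} refl refl = solve (a ∷ b ∷ g ∷ [])

  fraction-residue : ∀ {x} n d {c} → ↥ x * d ≡ n * ↧ x → ¬ (+ p ∣ d) → n ≈ c * d →
                     HasResidue x c
  fraction-residue {x} n d {c} eq p∤d (mk≈ n≈cd) =
    has-residue p∤↧ (mk≈ (∣-cancelʳ p∤d p∣shifted))
    where
      p∤↧ : ¬ (+ p ∣ ↧ x)
      p∤↧ p∣↧ = ↥↧-coprime x (∣-cancelʳ p∤d (subst (+ p ∣_) (sym eq) (∣n⇒∣m*n n p∣↧))) p∣↧
      shift : ∀ {a b} → a * d ≡ n * b → (a - c * b) * d ≡ (n - c * d) * b
      shift {a} {b} e = begin
        (a - c * b) * d   ≡⟨ solve (a ∷ b ∷ c ∷ d ∷ []) ⟩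
        a * d - c * d * b ≡⟨ cong (_- c * d * b) e ⟩
        n * b - c * d * b ≡⟨ solve (n ∷ b ∷ c ∷ d ∷ []) ⟩
        (n - c * d) * b   ∎
        where open ≡-Reasoning
      p∣shifted : + p ∣ (↥ x - c * ↧ x) * d
      p∣shifted = subst (+ p ∣_) (sym (shift {↥ x} {↧ x} eq)) (∣m⇒∣m*n (↧ x) n≈cd)

  residue-/ : ∀ i n .{{_ : ℕ.NonZero n}} {c} → ¬ (+ p ∣ + n) → i ≈ c * + n →
              HasResidue (i ℚ./ n) c
  residue-/ i n =
    fraction-residue i (+ n) (cross-multiply (↥ (i ℚ./ n)) (↧ (i ℚ./ n)) (↥-/ i n) (↧-/ i n))

  residue-ι : ∀ z → HasResidue (z ℚ./ 1) z
  residue-ι z = residue-/ z 1 ∤1 (≈-reflexive (sym (*-identityʳ z)))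

  residue-+ : ∀ {x y a b} → HasResidue x a → HasResidue y b → HasResidue (x ℚ.+ y) (a + b)
  residue-+ {x@record{}} {y@record{}} {a} {b} (has-residue p∤↧x ↥x≈) (has-residue p∤↧y ↥y≈) =
    residue-/ _ _ (∤-* p∤↧x p∤↧y) (sum (↥ x) (↧ x) (↥ y) (↧ y) ↥x≈ ↥y≈)
    where
      sum : ∀ n₁ d₁ n₂ d₂ → n₁ ≈ a * d₁ → n₂ ≈ b * d₂ →
            n₁ * d₂ + n₂ * d₁ ≈ (a + b) * (d₁ * d₂)
      sum n₁ d₁ n₂ d₂ h₁ h₂ = ≈-linear₂ d₂ d₁ h₁ h₂ (solve (n₁ ∷ a ∷ d₁ ∷ n₂ ∷ b ∷ d₂ ∷ []))

  residue-* : ∀ {x y a b} → HasResidue x a → HasResidue y b → HasResidue (x ℚ.* y) (a * b)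
  residue-* {x@record{}} {y@record{}} {a} {b} (has-residue p∤↧x ↥x≈) (has-residue p∤↧y ↥y≈) =
    residue-/ _ _ (∤-* p∤↧x p∤↧y) (product (↥ x) (↧ x) (↥ y) (↧ y) ↥x≈ ↥y≈)
    where
      product : ∀ n₁ d₁ n₂ d₂ → n₁ ≈ a * d₁ → n₂ ≈ b * d₂ → n₁ * n₂ ≈ (a * b) * (d₁ * d₂)
      product n₁ d₁ n₂ d₂ h₁ h₂ =
        ≈-linear₂ n₂ (a * d₁) h₁ h₂ (solve (n₁ ∷ a ∷ d₁ ∷ n₂ ∷ b ∷ d₂ ∷ []))

  residue-neg : ∀ {x a} → HasResidue x a → HasResidue (ℚ.- x) (- a)
  residue-neg {x} {a} (has-residue p∤↧x ↥x≈) =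
    has-residue (subst (λ d → ¬ (+ p ∣ d)) (sym (↧-neg x)) p∤↧x)
                (subst₂ (λ n d → n ≈ - a * d) (sym (↥-neg x)) (sym (↧-neg x))
                        (negation (↥ x) (↧ x) ↥x≈))
    where
      negation : ∀ n d → n ≈ a * d → - n ≈ - a * d
      negation n d h = ≈-linear₁ (- + 1) h (solve (n ∷ a ∷ d ∷ []))

  residue-÷ : ∀ {x y a d c} .{{_ : ℚ.NonZero y}} → HasResidue x a → HasResidue y d →
              ¬ (+ p ∣ d) → c * d ≈ a → HasResidue (x ÷ y) c
  residue-÷ {x} {y} {a} {d} {c} (has-residue p∤↧x ↥x≈) (has-residue p∤↧y ↥y≈) p∤d cd≈a =
    fraction-residue (↥ x * ↧ y) (↥ y * ↧ x) cross (∤-* p∤↥y p∤↧x)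
                     (quotient (↥ x) (↧ x) (↥ y) (↧ y) ↥x≈ ↥y≈)
    where
      z = x ÷ y
      z*y≡x : z ℚ.* y ≡ x
      z*y≡x = trans (ℚ.*-assoc x (ℚ.1/ y) y)
                    (trans (cong (x ℚ.*_) (ℚ.*-inverseˡ y)) (ℚ.*-identityʳ x))
      rearrange : ∀ a b c d e f → a * (e * f) ≡ (b * c) * d → b * (c * d) ≡ (a * f) * e
      rearrange a b c d e f eq = begin
        b * (c * d) ≡⟨ solve (b ∷ c ∷ d ∷ []) ⟩
        (b * c) * d ≡⟨ sym eq ⟩
        a * (e * f) ≡⟨ solve (a ∷ e ∷ f ∷ []) ⟩
        (a * f) * e ∎
        where open ≡-Reasoning
      cross : ↥ z * (↥ y * ↧ x) ≡ (↥ x * ↧ y) * ↧ z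
      cross = rearrange (↥ x) (↥ z) (↥ y) (↧ x) (↧ z) (↧ y)
        (subst (λ w → ↥ w * (↧ z * ↧ y) ≡ (↥ z * ↥ y) * ↧ w) z*y≡x
               (cross-multiply (↥ (z ℚ.* y)) (↧ (z ℚ.* y)) (↥-* z y) (↧-* z y)))
      p∤↥y : ¬ (+ p ∣ ↥ y)
      p∤↥y = ∤-resp-≈ ↥y≈ (∤-* p∤d p∤↧y)
      quotient : ∀ n₁ d₁ n₂ d₂ → n₁ ≈ a * d₁ → n₂ ≈ d * d₂ → n₁ * d₂ ≈ c * (n₂ * d₁)
      quotient n₁ d₁ n₂ d₂ n₁≈ n₂≈ =
        ≈-trans {b = a * d₁ * d₂}
          (≈-linear₁ d₂ n₁≈ (solve (n₁ ∷ a ∷ d₁ ∷ d₂ ∷ [])))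
          (≈-linear₂ (- (d₁ * d₂)) (- (c * d₁)) cd≈a n₂≈ (solve (a ∷ c ∷ d ∷ d₁ ∷ n₂ ∷ d₂ ∷ [])))

  residue-resp-≈ : ∀ {x a b} → HasResidue x a → a ≈ b → HasResidue x b
  residue-resp-≈ {x} {a} {b} (has-residue p∤↧x ↥x≈) a≈b =
    has-residue p∤↧x (shift (↥ x) (↧ x) ↥x≈ a≈b)
    where
      shift : ∀ n d → n ≈ a * d → a ≈ b → n ≈ b * d
      shift n d h₁ h₂ = ≈-linear₂ (+ 1) d h₁ h₂ (solve (n ∷ a ∷ b ∷ d ∷ []))

  infix 4 _↦_

  record _↦_ (mx : Maybe ℚ) (c : ℤ) : Set where
    constructor reduces
    field
      value   : ℚ
      defined : mx ≡ just value
      residue : HasResidue value c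

  ↦-≡ : ∀ {mx my c} → mx ≡ my → my ↦ c → mx ↦ c
  ↦-≡ refl r = r

  ↦-resp-≈ : ∀ {mx a b} → mx ↦ a → a ≈ b → mx ↦ b
  ↦-resp-≈ (reduces x refl r) a≈b = reduces x refl (residue-resp-≈ r a≈b)

  ↦-ι : ∀ z → ι z ↦ z
  ↦-ι z = reduces _ refl (residue-ι z)

  ↦-+ : ∀ {mx my a b} → mx ↦ a → my ↦ b → mx +M my ↦ a + b
  ↦-+ (reduces x refl r) (reduces y refl s) = reduces _ refl (residue-+ r s)

  ↦-- : ∀ {mx my a b} → mx ↦ a → my ↦ b → mx -M my ↦ a - b
  ↦-- (reduces x refl r) (reduces y refl s) = reduces _ refl (residue-+ r (residue-neg s))

  ↦-* : ∀ {mx my a b} → mx ↦ a → my ↦ b → mx *M my ↦ a * b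
  ↦-* (reduces x refl r) (reduces y refl s) = reduces _ refl (residue-* r s)

  ↦-/ : ∀ {mx my a d c} → mx ↦ a → my ↦ d → ¬ (+ p ∣ d) → c * d ≈ a → mx /M my ↦ c
  ↦-/ {d = d} (reduces x refl r) (reduces y refl s) p∤d cd≈a with y ℚ.≟ 0ℚ
  ... | yes refl = ⊥-elim (p∤d (subst (+ p ∣_) 0-d≡d (∣m⇒∣-m (_≈_.p∣a-b (HasResidue.↥≈ s)))))
    where
      0-d≡d : - (+ 0 - d * + 1) ≡ d
      0-d≡d = solve (d ∷ [])
  ... | no y≢0 = reduces _ refl (residue-÷ {{ℚ.≢-nonZero y≢0}} r s p∤d cd≈a)

  ↦⇒≡M : ∀ {mx my c} → mx ↦ c → my ↦ c → mx ≡M my [mod p ]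
  ↦⇒≡M {c = c} (reduces x refl r) (reduces y refl s) =
    x , y , refl , refl , p∤↧ r ∘ ∣ᵤ⇒∣ , p∤↧ s ∘ ∣ᵤ⇒∣ ,
    ∣⇒∣ᵤ (↥-vanishes (residue-+ r (residue-neg s)))
    where
      p∤↧ = HasResidue.↧-unit
      vanish : ∀ n d → n ≈ (c + - c) * d → n ≈ + 0
      vanish n d h = ≈-linear₁ (+ 1) h (solve (n ∷ d ∷ c ∷ []))
      ↥-vanishes : ∀ {w} → HasResidue w (c + - c) → + p ∣ ↥ w
      ↥-vanishes (has-residue _ ↥w≈) = ≈0⇒∣ (vanish _ _ ↥w≈)

module Recurrence (u v : ℤ) where

  open Seq u v
  open import Data.Nat using (_+_; _*_; _≤_; _<_; s≤s; z<s; s<s; suc; zero)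
  open import Data.Nat.Properties
    using (≤-refl; ≤-trans; ≤-reflexive; +-monoʳ-≤; +-mono-≤; m≤n+m; m≤n*m; n≤1+n; +-identityʳ)
  open import Data.Nat.DivMod
    using (_/_; +-distrib-/; m<n⇒m/n≡0; m*n/n≡m; m<n⇒m%n≡m; m*n%n≡0; [m+kn]%n≡m%n; m/n*n≤m)
  open import Data.Nat.Tactic.RingSolver using (solve-∀)
  open ≡-Reasoning

  3*q+3≡3+q*3 : ∀ q → 3 * q + 3 ≡ 3 + q * 3
  3*q+3≡3+q*3 = solve-∀

  [r+k*3]/3≡k : ∀ k r → r < 3 → (r + k * 3) / 3 ≡ k
  [r+k*3]/3≡k k r r<3 = begin
    (r + k * 3) / 3    ≡⟨ +-distrib-/ r (k * 3) small ⟩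
    r / 3 + k * 3 / 3  ≡⟨ cong₂ _+_ (m<n⇒m/n≡0 r<3) (m*n/n≡m k 3) ⟩
    k                  ∎
    where
      small : r % 3 + k * 3 % 3 < 3
      small = subst (_< 3) (sym (trans (cong₂ _+_ (m<n⇒m%n≡m r<3) (m*n%n≡0 k 3)) (+-identityʳ r)))
                    r<3

  [r+k*3]%3≡r : ∀ k r → r < 3 → (r + k * 3) % 3 ≡ r
  [r+k*3]%3≡r k r r<3 = trans ([m+kn]%n≡m%n r k 3) (m<n⇒m%n≡m r<3)

  block-cong : ∀ {rec rec′ : ℕ → Maybe ℚ × Maybe ℚ} k r →
               rec (k + 2) ≡ rec′ (k + 2) → rec (3 * k + 3) ≡ rec′ (3 * k + 3) →
               rec (3 * k + 2) ≡ rec′ (3 * k + 2) → block rec k r ≡ block rec′ k r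
  block-cong k 0 e₁ e₂ e₃ rewrite e₁ | e₂ | e₃ = refl
  block-cong k 1 e₁ e₂ e₃ rewrite e₁ | e₂ | e₃ = refl
  block-cong k 2 e₁ e₂ e₃ rewrite e₁ | e₂ | e₃ = refl
  block-cong k (suc (suc (suc _))) _ _ _ = refl

  block-cong-≤ : ∀ {rec rec′ : ℕ → Maybe ℚ × Maybe ℚ} k r →
                 (∀ {i} → i ≤ 3 * k + 3 → rec i ≡ rec′ i) → block rec k r ≡ block rec′ k r
  block-cong-≤ k r agree = block-cong k r
    (agree (+-mono-≤ (m≤n*m k 3) (n≤1+n 2))) (agree ≤-refl) (agree (+-monoʳ-≤ (3 * k) (n≤1+n 2)))

  ab-fuel : ∀ {m n} i → i ≤ m → i ≤ n → ab m i ≡ ab n i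
  ab-fuel {zero}  {zero}  _       _  _  = refl
  ab-fuel {zero}  {suc _} zero    _  _  = refl
  ab-fuel {suc _} {zero}  zero    _  _  = refl
  ab-fuel {suc _} {suc _} 0       _  _  = refl
  ab-fuel {suc _} {suc _} 1       _  _  = refl
  ab-fuel {suc _} {suc _} 2       _  _  = refl
  ab-fuel {suc _} {suc _} 3       _  _  = refl
  ab-fuel {suc m} {suc n} (suc (suc (suc (suc j)))) (s≤s i≤m) (s≤s i≤n) =
    block-cong-≤ (j / 3) (j % 3) λ i≤ →
      ab-fuel _ (≤-trans i≤ (≤-trans bound i≤m)) (≤-trans i≤ (≤-trans bound i≤n))
    where
      bound : 3 * (j / 3) + 3 ≤ 3 + j
      bound = ≤-trans (≤-reflexive (3*q+3≡3+q*3 (j / 3))) (+-monoʳ-≤ 3 (m/n*n≤m j 3))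

  ab-block : ∀ k r → r < 3 → ab (4 + (r + k * 3)) (4 + (r + k * 3)) ≡ block (λ i → ab i i) k r
  ab-block k r r<3 = begin
    block (ab (3 + j)) (j / 3) (j % 3)
      ≡⟨ cong₂ (block (ab (3 + j))) ([r+k*3]/3≡k k r r<3) ([r+k*3]%3≡r k r r<3) ⟩
    block (ab (3 + j)) k r
      ≡⟨ block-cong-≤ k r (λ i≤ → ab-fuel _ (≤-trans i≤ bound) ≤-refl) ⟩
    block (λ i → ab i i) k r
      ∎
    where
      j = r + k * 3
      bound : 3 * k + 3 ≤ 3 + j
      bound = ≤-trans (≤-reflexive (3*q+3≡3+q*3 k)) (+-monoʳ-≤ 3 (m≤n+m (k * 3) r))

  block-entry : ∀ k r → r < 3 →
                (α (3 * suc k + suc r) , β (3 * suc k + suc r)) ≡ block (λ i → ab i i) k r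
  block-entry k r r<3 = trans (cong (λ i → ab i i) (index k r)) (ab-block k r r<3)
    where
      index : ∀ k r → 3 * suc k + suc r ≡ 4 + (r + k * 3)
      index = solve-∀

  α-step₁ : ∀ k → α (3 * suc k + 1) ≡ ι (ℤ.- u)
  α-step₁ k = cong proj₁ (block-entry k 0 z<s)

  β-step₁ : ∀ k → β (3 * suc k + 1) ≡ β (k + 2) /M (β (3 * k + 3) *M β (3 * k + 2))
  β-step₁ k = cong proj₂ (block-entry k 0 z<s)

  β-step₂ : ∀ k → β (3 * suc k + 2) ≡ U *M U -M V -M β (3 * suc k + 1)
  β-step₂ k = trans (cong proj₂ (block-entry k 1 (s<s z<s)))
                    (cong (U *M U -M V -M_) (sym (β-step₁ k)))

  α-step₂ : ∀ k → α (3 * suc k + 2) ≡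
            U -M (α (k + 2) +M U *M V -M α (3 * k + 2) *M β (3 * suc k + 1)) /M β (3 * suc k + 2)
  α-step₂ k = trans (cong proj₁ (block-entry k 1 (s<s z<s)))
    (cong₂ (λ b₄ b₅ → U -M (α (k + 2) +M U *M V -M α (3 * k + 2) *M b₄) /M b₅)
           (sym (β-step₁ k)) (sym (cong proj₂ (block-entry k 1 (s<s z<s)))))

  α-step₃ : ∀ k → α (3 * suc k + 3) ≡ U -M α (3 * suc k + 2)
  α-step₃ k = trans (cong proj₁ (block-entry k 2 (s<s (s<s z<s))))
                    (cong (U -M_) (sym (cong proj₁ (block-entry k 1 (s<s z<s)))))

  β-step₃ : ∀ k → β (3 * suc k + 3) ≡ V -M α (3 * suc k + 2) *M α (3 * suc k + 3)
  β-step₃ k = trans (cong proj₂ (block-entry k 2 (s<s (s<s z<s))))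
    (cong₂ (λ a₅ a₆ → V -M a₅ *M a₆) (sym (cong proj₁ (block-entry k 1 (s<s z<s))))
                                     (sym (cong proj₁ (block-entry k 2 (s<s (s<s z<s))))))

module Blocks (p : ℕ) (p-prime : Prime p) (p-odd : p % 2 ≡ 1) (φ ψ u v : ℤ)
  (quartic : φ ℤ.^ 4 ℤ.+ + 4 ℤ.* φ ℤ.^ 2 ℤ.+ + 1 ≡ℤ + 0 [mod p ])
  (u≡φ : u ≡ℤ φ [mod p ]) (v≡-1 : v ≡ℤ -[1+ 0 ] [mod p ]) (φψ≡1 : φ ℤ.* ψ ≡ℤ + 1 [mod p ])
  where

  open ModularArithmetic p p-prime
  open Residues p p-prime
  open Seq u v
  open Recurrence u v
  open import Data.Integer using (_+_; _*_; _-_; -_; _^_)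
  open import Data.Integer.Properties using (*-identityʳ)
  open import Data.Integer.Divisibility.Signed using (_∣_; ∣m⇒∣m*n)
  open import Data.Integer.Tactic.RingSolver using (solve)
  open import Data.Nat.Properties using (+-suc; +-identityʳ; +-comm; *-comm; n<1+n)
  open import Data.Nat.DivMod using (_/_; m/n<m; m%n<n; m≡m%n+[m/n]*n)
  open import Data.Nat.Induction using (<-rec)
  open import Data.Nat.Tactic.RingSolver using () renaming (solve-∀ to ℕ-solve-∀)
  open import Data.Product using (∃₂; -,_)

  x^2≡x*x : ∀ x → x ^ 2 ≡ x * x
  x^2≡x*x x = cong (x *_) (*-identityʳ x)

  quartic≈0 : φ * φ * φ * φ + + 4 * (φ * φ) + + 1 ≈ + 0
  quartic≈0 = subst (_≈ + 0) (cong₂ (λ a b → a + + 4 * b + + 1) φ^4≡φ*φ*φ*φ (x^2≡x*x φ))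
                    (≈-from-mod quartic)
    where
      φ^4≡φ*φ*φ*φ : φ ^ 4 ≡ φ * φ * φ * φ
      φ^4≡φ*φ*φ*φ = trans (cong (λ t → φ * (φ * (φ * t))) (*-identityʳ φ)) (solve (φ ∷ []))

  φψ≈1 : φ * ψ ≈ + 1
  φψ≈1 = ≈-from-mod φψ≡1

  u≈φ : u ≈ φ
  u≈φ = ≈-from-mod u≡φ

  by-relations : ∀ {a b} c₁ c₂ →
                 a - b ≡ c₁ * (φ * φ * φ * φ + + 4 * (φ * φ) + + 1 - + 0) + c₂ * (φ * ψ - + 1) →
                 a ≈ b
  by-relations c₁ c₂ = ≈-linear₂ c₁ c₂ quartic≈0 φψ≈1

  U↦φ : U ↦ φ
  U↦φ = ↦-resp-≈ (↦-ι u) u≈φ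

  V↦-1 : V ↦ -[1+ 0 ]
  V↦-1 = ↦-resp-≈ (↦-ι v) (≈-from-mod v≡-1)

  -u↦-φ : ι (- u) ↦ - φ
  -u↦-φ = ↦-resp-≈ (↦-ι (- u)) (≈-linear₁ (- + 1) u≈φ (solve (u ∷ φ ∷ [])))

  one↦1 : one ↦ + 1
  one↦1 = ↦-ι (+ 1)

  φ-unit : ¬ (+ p ∣ φ)
  φ-unit = ∤-invertible φψ≈1

  ψ-unit : ¬ (+ p ∣ ψ)
  ψ-unit = ∤-invertible {ψ} {φ} (by-relations (+ 0) (+ 1) (solve (φ ∷ ψ ∷ [])))

  φ²+1-unit : ¬ (+ p ∣ φ * φ + + 1)
  φ²+1-unit = ∤-resp-≈ square (∤-neg (∤-* (∤2 p-odd) (∤-* φ-unit φ-unit)))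
            ∘ ∣m⇒∣m*n (φ * φ + + 1)
    where
      square : (φ * φ + + 1) * (φ * φ + + 1) ≈ - (+ 2 * (φ * φ))
      square = by-relations (+ 1) (+ 0) (solve (φ ∷ ψ ∷ []))

  φ+ψ-relation : (φ + ψ) * (φ * φ + + 1) + + 2 * φ ≈ + 0
  φ+ψ-relation = by-relations ψ (- (φ * φ * φ + + 3 * φ)) (solve (φ ∷ ψ ∷ []))

  Root : ℤ → Set
  Root A = A * A ≈ φ * A + (+ 1 + ψ * ψ)

  root-neg-ψ : Root (- ψ)
  root-neg-ψ = by-relations (+ 0) (+ 1) (solve (φ ∷ ψ ∷ []))

  root-φ+ψ : Root (φ + ψ)
  root-φ+ψ = by-relations (+ 0) (+ 1) (solve (φ ∷ ψ ∷ []))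

  root-flip : ∀ {A} → Root A → Root (φ - A)
  root-flip {A} r = ≈-linear₁ (+ 1) r (solve (A ∷ φ ∷ ψ ∷ []))

  root⇒β₃ : ∀ {A} → Root A → -[1+ 0 ] - A * (φ - A) ≈ ψ * ψ
  root⇒β₃ {A} r = ≈-linear₁ (+ 1) r (solve (A ∷ φ ∷ ψ ∷ []))

  -- β₁ = 1 does not follow the pattern φ² + 1 − D of the later blocks.
  record Block (j : ℕ) (A D : ℤ) : Set where
    field
      root   : Root A
      D-unit : ¬ (+ p ∣ D)
      α₂     : α (3 ℕ.* j ℕ.+ 2) ↦ A
      α₃     : α (3 ℕ.* j ℕ.+ 3) ↦ φ - A
      β₁     : .{{_ : ℕ.NonZero j}} → β (3 ℕ.* j ℕ.+ 1) ↦ φ * φ + + 1 - D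
      β₂     : β (3 ℕ.* j ℕ.+ 2) ↦ D
      β₃     : β (3 ℕ.* j ℕ.+ 3) ↦ ψ * ψ

  α₁ : ∀ j → α (3 ℕ.* j ℕ.+ 1) ↦ - φ
  α₁ ℕ.zero    = -u↦-φ
  α₁ (ℕ.suc k) = ↦-≡ (α-step₁ k) -u↦-φ

  next-block : ∀ {k A D a b A′ D′} → Block k A D → α (k ℕ.+ 2) ↦ a → β (k ℕ.+ 2) ↦ b →
               (φ * φ + + 1 - D′) * (ψ * ψ * D) ≈ b → ¬ (+ p ∣ D′) →
               (φ - A′) * D′ ≈ a + φ * -[1+ 0 ] - A * (φ * φ + + 1 - D′) → Root A′ →
               Block (ℕ.suc k) A′ D′
  next-block {k} {A} {D} {a} {b} {A′} {D′} blk α[k+2] β[k+2] β-quotient D′-unit α-quotient root′ =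
    record { root = root′ ; D-unit = D′-unit
           ; α₂ = α₂′ ; α₃ = α₃′ ; β₁ = β₁′ ; β₂ = β₂′ ; β₃ = β₃′ }
    where
      open Block blk
      β₁′ : β (3 ℕ.* ℕ.suc k ℕ.+ 1) ↦ φ * φ + + 1 - D′
      β₁′ = ↦-≡ (β-step₁ k) (↦-/ {c = φ * φ + + 1 - D′} β[k+2] (↦-* β₃ β₂)
                                 (∤-* (∤-* ψ-unit ψ-unit) D-unit) β-quotient)
      β₂′ : β (3 ℕ.* ℕ.suc k ℕ.+ 2) ↦ D′
      β₂′ = ↦-≡ (β-step₂ k) (↦-resp-≈ (↦-- (↦-- (↦-* U↦φ U↦φ) V↦-1) β₁′)
                                       (≈-reflexive (solve (φ ∷ D′ ∷ []))))
      α₂′ : α (3 ℕ.* ℕ.suc k ℕ.+ 2) ↦ A′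
      α₂′ = ↦-≡ (α-step₂ k)
        (↦-resp-≈ (↦-- U↦φ (↦-/ {c = φ - A′} (↦-- (↦-+ α[k+2] (↦-* U↦φ V↦-1)) (↦-* α₂ β₁′))
                                              β₂′ D′-unit α-quotient))
                  (≈-reflexive (solve (φ ∷ A′ ∷ []))))
      α₃′ : α (3 ℕ.* ℕ.suc k ℕ.+ 3) ↦ φ - A′
      α₃′ = ↦-≡ (α-step₃ k) (↦-- U↦φ α₂′)
      β₃′ : β (3 ℕ.* ℕ.suc k ℕ.+ 3) ↦ ψ * ψ
      β₃′ = ↦-≡ (β-step₃ k) (↦-resp-≈ (↦-- V↦-1 (↦-* α₂′ α₃′)) (root⇒β₃ root′))

  block₀ : Block 0 (- ψ) (φ * φ + + 1)
  block₀ = record { root = root-neg-ψ ; D-unit = φ²+1-unit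
                  ; α₂ = α₂′ ; α₃ = α₃′ ; β₁ = λ {{}} ; β₂ = β₂′ ; β₃ = β₃′ }
    where
      denominator : V -M U *M U ↦ - (φ * φ + + 1)
      denominator = ↦-resp-≈ (↦-- V↦-1 (↦-* U↦φ U↦φ)) (≈-reflexive (solve (φ ∷ [])))
      denominator-unit : ¬ (+ p ∣ - (φ * φ + + 1))
      denominator-unit = ∤-neg φ²+1-unit
      α₂′ : α 2 ↦ - ψ
      α₂′ = ↦-/ {c = - ψ} (↦-* U↦φ (↦-- (↦-- (↦-* (↦-ι (+ 2)) V↦-1) one↦1) (↦-* U↦φ U↦φ)))
                denominator denominator-unit (≈-linear₁ (+ 1) φ+ψ-relation (solve (φ ∷ ψ ∷ [])))
      α₃′ : α 3 ↦ φ - - ψ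
      α₃′ = ↦-/ {c = φ - - ψ} (↦-* -u↦-φ (↦-- V↦-1 one↦1))
                denominator denominator-unit (≈-linear₁ (- + 1) φ+ψ-relation (solve (φ ∷ ψ ∷ [])))
      β₂′ : β 2 ↦ φ * φ + + 1
      β₂′ = ↦-resp-≈ (↦-- (↦-* U↦φ U↦φ) V↦-1) (≈-reflexive (solve (φ ∷ [])))
      β₃′ : β 3 ↦ ψ * ψ
      β₃′ = ↦-/ {c = ψ * ψ}
        (↦-- (↦-+ (↦-+ (↦-* U↦φ U↦φ) (↦-* (↦-* (↦-* U↦φ U↦φ) U↦φ) U↦φ)) (↦-* (↦-* V↦-1 V↦-1) V↦-1))
             (↦-* (↦-* (↦-* (↦-ι (+ 3)) U↦φ) U↦φ) V↦-1))
        (↦-* denominator denominator) (∤-* denominator-unit denominator-unit)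
        (by-relations (ψ * ψ - + 1) (- (+ 2 * (φ * ψ + + 1))) (solve (φ ∷ ψ ∷ [])))

  record Children (m : ℕ) (A D : ℤ) : Set where
    field
      child₀ : Block (3 ℕ.* m) (- ψ) D
      child₁ : Block (ℕ.suc (3 ℕ.* m)) (φ - A) (+ 1)
      child₂ : Block (ℕ.suc (ℕ.suc (3 ℕ.* m))) (φ + ψ) (φ * φ)

  child₁-of : ∀ {m A D} → Block m A D → Block (3 ℕ.* m) (- ψ) D →
              Block (ℕ.suc (3 ℕ.* m)) (φ - A) (+ 1)
  child₁-of {A = A} {D} parent child₀ =
    next-block {A′ = φ - A} {D′ = + 1} child₀ (Block.α₂ parent) (Block.β₂ parent)
      (by-relations (+ 0) (D * (φ * ψ + + 1)) (solve (φ ∷ ψ ∷ D ∷ []))) ∤1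
      (by-relations (+ 0) (- φ) (solve (φ ∷ ψ ∷ A ∷ []))) (root-flip (Block.root parent))

  child₂-of : ∀ {m A D} → Block m A D → Block (ℕ.suc (3 ℕ.* m)) (φ - A) (+ 1) →
              Block (ℕ.suc (ℕ.suc (3 ℕ.* m))) (φ + ψ) (φ * φ)
  child₂-of {m} {A} parent child₁ =
    next-block {A′ = φ + ψ} {D′ = φ * φ} child₁
      (↦-≡ (cong α shift) (Block.α₃ parent)) (↦-≡ (cong β shift) (Block.β₃ parent))
      (≈-reflexive (solve (φ ∷ ψ ∷ []))) (∤-* φ-unit φ-unit)
      (by-relations (+ 0) (- φ) (solve (φ ∷ ψ ∷ A ∷ []))) root-φ+ψ
    where
      shift : ℕ.suc (3 ℕ.* m) ℕ.+ 2 ≡ 3 ℕ.* m ℕ.+ 3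
      shift = sym (+-suc (3 ℕ.* m) 2)

  child₀-of : ∀ {m A D} → Block (ℕ.suc m) A D → Block (ℕ.suc (ℕ.suc (3 ℕ.* m))) (φ + ψ) (φ * φ) →
              Block (3 ℕ.* ℕ.suc m) (- ψ) D
  child₀-of {m} {D = D} parent previous = subst (λ j → Block j (- ψ) D) (index m)
    (next-block {A′ = - ψ} {D′ = D} previous
      (↦-≡ (cong α (shift m)) (α₁ (ℕ.suc m))) (↦-≡ (cong β (shift m)) (Block.β₁ parent))
      (by-relations (+ 0) ((φ * φ + + 1 - D) * (φ * ψ + + 1)) (solve (φ ∷ ψ ∷ D ∷ [])))
      (Block.D-unit parent) (≈-linear₁ (+ 1) φ+ψ-relation (solve (φ ∷ ψ ∷ D ∷ []))) root-neg-ψ)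
    where
      shift : ∀ m → ℕ.suc (ℕ.suc (3 ℕ.* m)) ℕ.+ 2 ≡ 3 ℕ.* ℕ.suc m ℕ.+ 1
      shift = ℕ-solve-∀
      index : ∀ m → ℕ.suc (ℕ.suc (ℕ.suc (3 ℕ.* m))) ≡ 3 ℕ.* ℕ.suc m
      index = ℕ-solve-∀

  children : ∀ {m A D} → Block m A D → Block (3 ℕ.* m) (- ψ) D → Children m A D
  children parent c₀ = record { child₀ = c₀ ; child₁ = c₁ ; child₂ = child₂-of parent c₁ }
    where
      c₁ = child₁-of parent c₀

  record Family (m : ℕ) : Set where
    field
      A D       : ℤ
      parent    : Block m A D
      offspring : Children m A D

  reindex : ∀ {i j A D} → i ≡ j → Block i A D → ∃₂ (Block j)
  reindex refl b = -, -, b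

  child-at : ∀ {q} → Family q → ∀ r → r ℕ.< 3 → ∃₂ (Block (3 ℕ.* q ℕ.+ r))
  child-at {q} f 0 _ = reindex (sym (+-identityʳ (3 ℕ.* q))) (Children.child₀ (Family.offspring f))
  child-at {q} f 1 _ = reindex (+-comm 1 (3 ℕ.* q)) (Children.child₁ (Family.offspring f))
  child-at {q} f 2 _ = reindex (+-comm 2 (3 ℕ.* q)) (Children.child₂ (Family.offspring f))
  child-at f (ℕ.suc (ℕ.suc (ℕ.suc _))) (ℕ.s≤s (ℕ.s≤s (ℕ.s≤s ())))

  family-from : ∀ {m} → ∃₂ (Block (ℕ.suc m)) → Block (ℕ.suc (ℕ.suc (3 ℕ.* m))) (φ + ψ) (φ * φ) →
                Family (ℕ.suc m)
  family-from (A , D , parent) previous = record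
    { A = A ; D = D ; parent = parent ; offspring = children parent (child₀-of parent previous) }

  3*[n/3]+n%3≡n : ∀ n → 3 ℕ.* (n / 3) ℕ.+ n % 3 ≡ n
  3*[n/3]+n%3≡n n = sym (trans (m≡m%n+[m/n]*n n 3)
                               (trans (+-comm (n % 3) _) (cong (ℕ._+ n % 3) (*-comm (n / 3) 3))))

  family : ∀ m → Family m
  family = <-rec Family grow
    where
      grow : ∀ m → (∀ {q} → q ℕ.< m → Family q) → Family m
      grow ℕ.zero    _       = record { A = - ψ ; D = φ * φ + + 1
                                      ; parent = block₀ ; offspring = children block₀ block₀ }
      grow (ℕ.suc m) earlier =
        family-from parent (Children.child₂ (Family.offspring (earlier (n<1+n m))))
        where
          n = ℕ.suc m
          parent : ∃₂ (Block n)
          parent = subst (∃₂ ∘ Block) (3*[n/3]+n%3≡n n)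
                         (child-at (earlier (m/n<m n 3 (ℕ.s<s ℕ.z<s))) (n % 3) (m%n<n n 3))

  parent : ∀ k → Block k (Family.A (family k)) (Family.D (family k))
  parent k = Family.parent (family k)

  offspring : ∀ k → Children k (Family.A (family k)) (Family.D (family k))
  offspring k = Family.offspring (family k)

  index₉ : ∀ k r s → 3 ℕ.* (r ℕ.+ 3 ℕ.* k) ℕ.+ s ≡ 9 ℕ.* k ℕ.+ (3 ℕ.* r ℕ.+ s)
  index₉ = ℕ-solve-∀

  index₃ : ∀ k s → 3 ℕ.* ℕ.suc k ℕ.+ s ≡ 3 ℕ.* k ℕ.+ (3 ℕ.+ s)
  index₃ = ℕ-solve-∀

  ≡M-ι : ∀ {mx} c → mx ↦ c → mx ≡M ι c [mod p ]
  ≡M-ι c r = ↦⇒≡M r (↦-ι c)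

  α[3k+1] : ∀ k → α (3 ℕ.* k ℕ.+ 1) ≡M ι (ℤ.- φ) [mod p ]
  α[3k+1] k = ≡M-ι (- φ) (α₁ k)

  α[3k+2]+α[3k+3] : ∀ k → α (3 ℕ.* k ℕ.+ 2) +M α (3 ℕ.* k ℕ.+ 3) ≡M ι φ [mod p ]
  α[3k+2]+α[3k+3] k = ≡M-ι φ (sum (parent k))
    where
      sum : ∀ {A D} → Block k A D → α (3 ℕ.* k ℕ.+ 2) +M α (3 ℕ.* k ℕ.+ 3) ↦ φ
      sum {A} b = ↦-resp-≈ (↦-+ (Block.α₂ b) (Block.α₃ b)) (≈-reflexive (solve (A ∷ φ ∷ [])))

  α[9k+2] : ∀ k → α (9 ℕ.* k ℕ.+ 2) ≡M ι (ℤ.- ψ) [mod p ]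
  α[9k+2] k = ≡M-ι (- ψ)
    (↦-≡ (cong α (sym (index₉ k 0 2))) (Block.α₂ (Children.child₀ (offspring k))))

  α[9k+5]≡α[3k+3] : ∀ k → α (9 ℕ.* k ℕ.+ 5) ≡M α (3 ℕ.* k ℕ.+ 3) [mod p ]
  α[9k+5]≡α[3k+3] k =
    ↦⇒≡M (↦-≡ (cong α (sym (index₉ k 1 2))) (Block.α₂ (Children.child₁ (offspring k))))
         (Block.α₃ (parent k))

  α[9k+8] : ∀ k → α (9 ℕ.* k ℕ.+ 8) ≡M ι (φ ℤ.+ ψ) [mod p ]
  α[9k+8] k = ≡M-ι (φ + ψ)
    (↦-≡ (cong α (sym (index₉ k 2 2))) (Block.α₂ (Children.child₂ (offspring k))))

  β[1] : β 1 ≡M ι (+ 1) [mod p ]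
  β[1] = ≡M-ι (+ 1) one↦1

  β[2] : β 2 ≡M ι (φ ℤ.^ 2 ℤ.+ + 1) [mod p ]
  β[2] = ≡M-ι (φ ^ 2 + + 1)
    (↦-resp-≈ (Block.β₂ block₀) (≈-reflexive (cong (_+ + 1) (sym (x^2≡x*x φ)))))

  β[3k+3] : ∀ k → β (3 ℕ.* k ℕ.+ 3) ≡M ι (ψ ℤ.^ 2) [mod p ]
  β[3k+3] k = ≡M-ι (ψ ^ 2) (↦-resp-≈ (Block.β₃ (parent k)) (≈-reflexive (sym (x^2≡x*x ψ))))

  β[3k+4]+β[3k+5] : ∀ k →
                    β (3 ℕ.* k ℕ.+ 4) +M β (3 ℕ.* k ℕ.+ 5) ≡M ι (φ ℤ.^ 2 ℤ.+ + 1) [mod p ]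
  β[3k+4]+β[3k+5] k = ≡M-ι (φ ^ 2 + + 1)
    (↦-≡ (cong₂ _+M_ (cong β (sym (index₃ k 1))) (cong β (sym (index₃ k 2))))
         (↦-resp-≈ (sum (parent (ℕ.suc k))) (≈-reflexive (cong (_+ + 1) (sym (x^2≡x*x φ))))))
    where
      sum : ∀ {A D} → Block (ℕ.suc k) A D →
            β (3 ℕ.* ℕ.suc k ℕ.+ 1) +M β (3 ℕ.* ℕ.suc k ℕ.+ 2) ↦ φ * φ + + 1
      sum {D = D} b = ↦-resp-≈ (↦-+ (Block.β₁ b) (Block.β₂ b)) (≈-reflexive (solve (φ ∷ D ∷ [])))

  β[9k+1]≡β[3k+1] : ∀ k → β (9 ℕ.* k ℕ.+ 1) ≡M β (3 ℕ.* k ℕ.+ 1) [mod p ]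
  β[9k+1]≡β[3k+1] ℕ.zero    = ↦⇒≡M one↦1 one↦1
  β[9k+1]≡β[3k+1] (ℕ.suc k) =
    ↦⇒≡M (↦-≡ (cong β (sym (index₉ (ℕ.suc k) 0 1)))
              (Block.β₁ (Children.child₀ (offspring (ℕ.suc k)))))
         (Block.β₁ (parent (ℕ.suc k)))

  β[9k+4] : ∀ k → β (9 ℕ.* k ℕ.+ 4) ≡M ι (φ ℤ.^ 2) [mod p ]
  β[9k+4] k = ≡M-ι (φ ^ 2)
    (↦-≡ (cong β (sym (index₉ k 1 1)))
         (↦-resp-≈ (Block.β₁ (Children.child₁ (offspring k))) (≈-reflexive φ*φ+1-1≡φ^2)))
    where
      φ*φ+1-1≡φ^2 : φ * φ + + 1 - + 1 ≡ φ ^ 2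
      φ*φ+1-1≡φ^2 = begin
        φ * φ + + 1 - + 1 ≡⟨ solve (φ ∷ []) ⟩
        φ * φ             ≡⟨ x^2≡x*x φ ⟨
        φ ^ 2             ∎
        where open ≡-Reasoning

  β[9k+7] : ∀ k → β (9 ℕ.* k ℕ.+ 7) ≡M ι (+ 1) [mod p ]
  β[9k+7] k = ≡M-ι (+ 1)
    (↦-≡ (cong β (sym (index₉ k 2 1)))
         (↦-resp-≈ (Block.β₁ (Children.child₂ (offspring k))) (≈-reflexive (solve (φ ∷ [])))))

lemma4 : (p : ℕ) → Prime p → p % 2 ≡ 1 →
    (φ u v : ℤ) →
    (φ ℤ.^ 4 ℤ.+ + 4 ℤ.* φ ℤ.^ 2 ℤ.+ + 1) ≡ℤ + 0 [mod p ] →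
    u ≡ℤ φ [mod p ] →
    v ≡ℤ -[1+ 0 ] [mod p ] →
    -- ψ plays the role of φ⁻¹ modulo p (any inverse of φ mod p)
    (ψ : ℤ) → φ ℤ.* ψ ≡ℤ + 1 [mod p ] →
    (k : ℕ) →
    let open Seq u v in
      (α (3 ℕ.* k ℕ.+ 1) ≡M ι (ℤ.- φ) [mod p ])
    × (α (3 ℕ.* k ℕ.+ 2) +M α (3 ℕ.* k ℕ.+ 3) ≡M ι φ [mod p ])
    × (α (9 ℕ.* k ℕ.+ 2) ≡M ι (ℤ.- ψ) [mod p ])
    × (α (9 ℕ.* k ℕ.+ 5) ≡M α (3 ℕ.* k ℕ.+ 3) [mod p ])
    × (α (9 ℕ.* k ℕ.+ 8) ≡M ι (φ ℤ.+ ψ) [mod p ])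
    × (β 1 ≡M ι (+ 1) [mod p ])
    × (β 2 ≡M ι (φ ℤ.^ 2 ℤ.+ + 1) [mod p ])
    × (β (3 ℕ.* k ℕ.+ 3) ≡M ι (ψ ℤ.^ 2) [mod p ])
    × (β (3 ℕ.* k ℕ.+ 4) +M β (3 ℕ.* k ℕ.+ 5) ≡M ι (φ ℤ.^ 2 ℤ.+ + 1) [mod p ])
    × (β (9 ℕ.* k ℕ.+ 1) ≡M β (3 ℕ.* k ℕ.+ 1) [mod p ])
    × (β (9 ℕ.* k ℕ.+ 4) ≡M ι (φ ℤ.^ 2) [mod p ])
    × (β (9 ℕ.* k ℕ.+ 7) ≡M ι (+ 1) [mod p ])
lemma4 p p-prime p-odd φ u v quartic u≡φ v≡-1 ψ φψ≡1 k =
    α[3k+1] k , α[3k+2]+α[3k+3] k , α[9k+2] k , α[9k+5]≡α[3k+3] k , α[9k+8] k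
  , β[1] , β[2] , β[3k+3] k , β[3k+4]+β[3k+5] k , β[9k+1]≡β[3k+1] k , β[9k+4] k , β[9k+7] k
  where
    open Blocks p p-prime p-odd φ ψ u v quartic u≡φ v≡-1 φψ≡1
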